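{- Let $T$ be a tree with vertex set $\{1,\ldots,n\}$, with $potBeg$ and $potEnd$ defined as follows: for $x\le y$, $x\in potBeg(y)$ iff every vertex of $\{x,\ldots,y\}$ lies in the connected component of $x$ in $T_{\ge x}$, and $y\in potEnd(x)$ iff every vertex of $\{x,\ldots,y\}$ lies in the connected component of $y$ in $T_{\le y}$. Let $RSplitter[x]=\min\{y>x: x\notin potBeg(y)\}$ and $LSplitter[y]=\max\{x<y: y\notin potEnd(x)\}$ (with values $+\infty$, resp. $-\infty$, if the set is empty). Then $RSplitter[x]$ is the minimum $z>x$ such that the path of $T$ between $x$ and $z$ contains a vertex $x'<x$ ($+\infty$ if no such $z$ exists), and symmetrically $LSplitter[y]$ is the maximum $z<y$ such that the path of $T$ between $y$ and $z$ contains a vertex $y'>y$ ($-\infty$ if no such $z$ exists).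
   Context: $T_{\ge x}$ denotes the subgraph of $T$ induced by $\{x,\ldots,n\}$ and $T_{\le y}$ the subgraph induced by $\{1,\ldots,y\}$. -}

module Defs where

open import Data.Nat using (ℕ; _≤_; _<_; _>_)
open import Data.Nat.Base using (suc)
open import Data.List using (List; []; _∷_; length)
open import Data.List.Membership.Propositional using (_∈_)
open import Data.List.Relation.Unary.Unique.Propositional using (Unique)
open import Data.Product using (Σ; ∃; ∃-syntax; _×_; _,_)
open import Data.Maybe using (Maybe; just; nothing)
open import Relation.Nullary using (¬_)
open import Relation.Binary using (Decidable)
open import Level using (0ℓ)

Vertex : ℕ → ℕ → Set
Vertex n v = 1 ≤ v × v ≤ n

record Graph (n : ℕ) : Set₁ where
  field
    Adj      : ℕ → ℕ → Set
    adj?     : Decidable Adj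
    adj-vert : ∀ {u v} → Adj u v → Vertex n u × Vertex n v
    adj-sym  : ∀ {u v} → Adj u v → Adj v u
    adj-irr  : ∀ {u} → ¬ Adj u u

module _ {n : ℕ} (G : Graph n) where
  open Graph G

  -- Walk G S u v vs : a walk from u to v, listing its vertices vs (in order),
  -- all of which satisfy S (i.e. a walk in the subgraph induced by S).
  data Walk (S : ℕ → Set) : ℕ → ℕ → List ℕ → Set where
    single : ∀ {v} → Vertex n v → S v → Walk S v v (v ∷ [])
    step   : ∀ {u w v vs} → S u → Adj u w → Walk S w v vs → Walk S u v (u ∷ vs)

  IsPath : ℕ → ℕ → List ℕ → Set
  IsPath u v vs = Walk (λ _ → Data.Unit.⊤) u v vs × Unique vs
    where import Data.Unit

  Connected : Set
  Connected = ∀ u v → Vertex n u → Vertex n v →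
              ∃[ vs ] Walk (λ _ → Data.Unit.⊤) u v vs
    where import Data.Unit

  HasCycle : Set
  HasCycle = Σ ℕ λ u → Σ ℕ λ v → Σ (List ℕ) λ vs →
             IsPath u v vs × 3 ≤ length vs × Adj v u

  Acyclic : Set
  Acyclic = ¬ HasCycle

  InComponent : (ℕ → Set) → ℕ → ℕ → Set
  InComponent S x w = ∃[ vs ] Walk S x w vs

record Tree (n : ℕ) : Set₁ where
  field
    graph     : Graph n
    connected : Connected graph
    acyclic   : Acyclic graph
  open Graph graph public

module _ {n : ℕ} (T : Tree n) where
  open Tree T

  PotBeg : ℕ → ℕ → Set
  PotBeg x y = x ≤ y × (∀ w → x ≤ w → w ≤ y → InComponent graph (λ u → x ≤ u) x w)

  PotEnd : ℕ → ℕ → Set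
  PotEnd x y = x ≤ y × (∀ w → x ≤ w → w ≤ y → InComponent graph (λ u → u ≤ y) y w)

  RSplitSet : ℕ → ℕ → Set
  RSplitSet x y = x < y × y ≤ n × ¬ PotBeg x y

  LSplitSet : ℕ → ℕ → Set
  LSplitSet y x = 1 ≤ x × x < y × ¬ PotEnd x y

  RPathSet : ℕ → ℕ → Set
  RPathSet x z = x < z × z ≤ n ×
    (∃[ vs ] IsPath graph x z vs × ∃[ x' ] (x' ∈ vs × x' < x))

  LPathSet : ℕ → ℕ → Set
  LPathSet y z = 1 ≤ z × z < y ×
    (∃[ vs ] IsPath graph y z vs × ∃[ y' ] (y' ∈ vs × y' > y))

-- IsMinOrInf P r : r = min P, where nothing stands for +∞ (P empty)
IsMinOrInf : (ℕ → Set) → Maybe ℕ → Set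
IsMinOrInf P (just m) = P m × (∀ k → P k → m ≤ k)
IsMinOrInf P nothing  = ∀ k → ¬ P k

-- IsMaxOrInf P r : r = max P, where nothing stands for -∞ (P empty)
IsMaxOrInf : (ℕ → Set) → Maybe ℕ → Set
IsMaxOrInf P (just m) = P m × (∀ k → P k → k ≤ m)
IsMaxOrInf P nothing  = ∀ k → ¬ P k

-- Path-connectivity inside T_{≥x} is decided by the unique path of T: since an acyclic graph has
-- only one path between two vertices, every walk from x to w passes through all vertices of that
-- path.  Hence w lies in the component of x in T_{≥x} iff the path from x to w avoids {1,…,x-1},
-- so x ∉ potBeg(y) iff some w ∈ [x,y] has a path from x through a smaller vertex.  The sets
-- {y > x : x ∉ potBeg(y)} and {z > x : the x–z path dips below x} thus differ only by elements
-- dominated by elements of the second, and have the same minimum.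
module Submission where

open import Defs
open import Data.Nat using (ℕ; suc; _≤_; _<_; _≤?_; _≟_; z≤n; s≤s)
open import Data.Nat.Properties using (≤-refl; ≤-trans; ≤-antisym; <⇒≤; <⇒≱; ≰⇒>; ≤∧≢⇒<; anyUpTo?)
open import Data.Maybe using (Maybe; just; nothing)
open import Data.Product using (∃-syntax; _×_; _,_; proj₁; proj₂)
open import Data.Sum using (_⊎_; inj₁; inj₂)
open import Data.Unit using (⊤; tt)
open import Data.List using ([]; _∷_; _++_; length)
open import Data.List.Relation.Unary.Any using (here; there; any?)
open import Data.List.Relation.Unary.All using (All; []; _∷_; all?; lookup)
open import Data.List.Relation.Unary.All.Properties using (¬Any⇒All¬; ¬All⇒Any¬)
open import Data.List.Relation.Unary.AllPairs using ([]; _∷_)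
open import Data.List.Membership.Propositional using (_∈_; find)
open import Data.List.Relation.Unary.Unique.Propositional using (Unique)
open import Relation.Nullary using (¬_; Dec; yes; no; contradiction)
open import Relation.Nullary.Decidable using (map′; ¬?; decidable-stable)
open import Relation.Unary using (_⊆_; Decidable)
open import Relation.Binary.PropositionalEquality using (_≢_; refl; sym; subst)
open import Function using (_∘_)
open import Function.Bundles using (_⇔_; mk⇔)

minOrInf-coinitial : {P Q : ℕ → Set} → Q ⊆ P → (∀ {k} → P k → ∃[ w ] Q w × w ≤ k) →
                     ∀ r → IsMinOrInf P r ⇔ IsMinOrInf Q r
minOrInf-coinitial {P} {Q} Q⊆P below (just m) = mk⇔ to from
  where
  to : IsMinOrInf P (just m) → IsMinOrInf Q (just m)
  to (Pm , m-min) with below Pm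
  ... | w , Qw , w≤m = subst Q (≤-antisym w≤m (m-min w (Q⊆P Qw))) Qw , λ k → m-min k ∘ Q⊆P
  from : IsMinOrInf Q (just m) → IsMinOrInf P (just m)
  from (Qm , m-min) = Q⊆P Qm , λ k Pk → let w , Qw , w≤k = below Pk in ≤-trans (m-min w Qw) w≤k
minOrInf-coinitial Q⊆P below nothing =
  mk⇔ (λ noP k → noP k ∘ Q⊆P) (λ noQ k Pk → noQ _ (proj₁ (proj₂ (below Pk))))

maxOrInf-cofinal : {P Q : ℕ → Set} → Q ⊆ P → (∀ {k} → P k → ∃[ w ] Q w × k ≤ w) →
                   ∀ r → IsMaxOrInf P r ⇔ IsMaxOrInf Q r
maxOrInf-cofinal {P} {Q} Q⊆P above (just m) = mk⇔ to from
  where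
  to : IsMaxOrInf P (just m) → IsMaxOrInf Q (just m)
  to (Pm , m-max) with above Pm
  ... | w , Qw , m≤w = subst Q (≤-antisym (m-max w (Q⊆P Qw)) m≤w) Qw , λ k → m-max k ∘ Q⊆P
  from : IsMaxOrInf Q (just m) → IsMaxOrInf P (just m)
  from (Qm , m-max) = Q⊆P Qm , λ k Pk → let w , Qw , k≤w = above Pk in ≤-trans k≤w (m-max w Qw)
maxOrInf-cofinal Q⊆P above nothing =
  mk⇔ (λ noP k → noP k ∘ Q⊆P) (λ noQ k Pk → noQ _ (proj₁ (proj₂ (above Pk))))

¬∀⟶∃¬-interval : {P : ℕ → Set} (a b : ℕ) → (∀ {w} → a ≤ w → w ≤ b → Dec (P w)) →
                 ¬ (∀ w → a ≤ w → w ≤ b → P w) → ∃[ w ] a ≤ w × w ≤ b × ¬ P w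
¬∀⟶∃¬-interval {P} a b P? ¬∀ = extract (anyUpTo? counterexample? (suc b))
  where
  counterexample? : ∀ w → Dec (a ≤ w × w ≤ b × ¬ P w)
  counterexample? w with a ≤? w | w ≤? b
  ... | yes a≤w | yes w≤b = map′ (λ ¬Pw → a≤w , w≤b , ¬Pw) (proj₂ ∘ proj₂) (¬? (P? a≤w w≤b))
  ... | no a≰w  | _       = no (a≰w ∘ proj₁)
  ... | yes _   | no w≰b  = no (w≰b ∘ proj₁ ∘ proj₂)
  extract : Dec (∃[ w ] w < suc b × a ≤ w × w ≤ b × ¬ P w) → ∃[ w ] a ≤ w × w ≤ b × ¬ P w
  extract (yes (w , _ , cx)) = w , cx
  extract (no none) = contradiction (λ w a≤w w≤b →
    decidable-stable (P? a≤w w≤b) λ ¬Pw → none (w , s≤s w≤b , a≤w , w≤b , ¬Pw)) ¬∀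

module WalkProperties {n : ℕ} (G : Graph n) where
  open Graph G

  walk-weaken : ∀ {S u v vs} → Walk G S u v vs → Walk G (λ _ → ⊤) u v vs
  walk-weaken (single vv _) = single vv tt
  walk-weaken (step _ a W)  = step tt a (walk-weaken W)

  walk-restrict : ∀ {S u v vs} → Walk G (λ _ → ⊤) u v vs → All S vs → Walk G S u v vs
  walk-restrict (single vv _) (s ∷ [])  = single vv s
  walk-restrict (step _ a W)  (s ∷ ss) = step s a (walk-restrict W ss)

  module _ {S : ℕ → Set} where

    walk-All : ∀ {u v vs} → Walk G S u v vs → All S vs
    walk-All (single _ s) = s ∷ []
    walk-All (step s _ W) = s ∷ walk-All W

    walk-head-∈ : ∀ {u v vs} → Walk G S u v vs → u ∈ vs
    walk-head-∈ (single _ _) = here refl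
    walk-head-∈ (step _ _ _) = here refl

    walk-last-∈ : ∀ {u v vs} → Walk G S u v vs → v ∈ vs
    walk-last-∈ (single _ _) = here refl
    walk-last-∈ (step _ _ W) = there (walk-last-∈ W)

    walk-length-≥2 : ∀ {u v vs} → Walk G S u v vs → u ≢ v → 2 ≤ length vs
    walk-length-≥2 (single _ _)             u≢v = contradiction refl u≢v
    walk-length-≥2 (step _ _ (single _ _))  _   = s≤s (s≤s z≤n)
    walk-length-≥2 (step _ _ (step _ _ _))  _   = s≤s (s≤s z≤n)

    walk-++ : ∀ {u v t vs ws} → Walk G S u v vs → Walk G S v t ws → ∃[ zs ] Walk G S u t zs
    walk-++ (single _ _) W₂ = _ , W₂
    walk-++ (step s a W₁) W₂ = _ , step s a (proj₂ (walk-++ W₁ W₂))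

    walk-snoc : ∀ {u v t vs} → Walk G S u v vs → Adj v t → S t → Walk G S u t (vs ++ t ∷ [])
    walk-snoc (single _ s) a St  = step s a (single (proj₂ (adj-vert a)) St)
    walk-snoc (step s a′ W) a St = step s a′ (walk-snoc W a St)

    walk-reverse : ∀ {u v vs} → Walk G S u v vs → ∃[ zs ] Walk G S v u zs
    walk-reverse (single vv s) = _ , single vv s
    walk-reverse (step s a W)  = _ , walk-snoc (proj₂ (walk-reverse W)) (adj-sym a) s

    path-suffix : ∀ {a u v ws} → Walk G S a v ws → Unique ws → u ∈ ws →
                  ∃[ ws′ ] Walk G S u v ws′ × Unique ws′
    path-suffix W@(single _ _) uq (here refl) = _ , W , uq
    path-suffix W@(step _ _ _) uq (here refl) = _ , W , uq
    path-suffix (step _ _ W) (_ ∷ uq) (there u∈ws) = path-suffix W uq u∈ws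

    walk⇒path : ∀ {u v vs} → Walk G S u v vs → ∃[ ws ] Walk G S u v ws × Unique ws
    walk⇒path (single vv s) = _ , single vv s , [] ∷ []
    walk⇒path (step {u} s a W) with walk⇒path W
    ... | ws , W′ , uq with any? (u ≟_) ws
    ...   | yes u∈ws = path-suffix W′ uq u∈ws
    ...   | no u∉ws  = u ∷ ws , step s a W′ , ¬Any⇒All¬ ws u∉ws ∷ uq

  no-detour : Acyclic G → ∀ {a p q vs} → Adj a p → Adj a q → p ≢ q →
              ¬ Walk G (a ≢_) p q vs
  no-detour acyclic {a} {q = q} a~p a~q p≢q W with walk⇒path W
  ... | R , P , uq =
    acyclic (a , q , a ∷ R , (step tt a~p (walk-weaken P) , walk-All P ∷ uq) ,
             s≤s (walk-length-≥2 P p≢q) , adj-sym a~q)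

  -- Two paths with the same ends that leave a along different edges close up into a cycle.
  path-⊆ : Acyclic G → ∀ {a b vs ws} → IsPath G a b vs → IsPath G a b ws → ∀ {z} → z ∈ vs → z ∈ ws
  path-⊆ _ (single _ _ , _) (Q , _) (here refl) = walk-head-∈ Q
  path-⊆ _ (step _ _ _ , _) (Q , _) (here refl) = walk-head-∈ Q
  path-⊆ _ (single _ _ , _) _ (there ())
  path-⊆ _ (step _ _ P , a∉P ∷ _) (single _ _ , _) (there _) = contradiction refl (lookup a∉P (walk-last-∈ P))
  path-⊆ acyclic (step {w = p} _ a~p P , a∉P ∷ uP) (step {w = q} _ a~q Q , a∉Q ∷ uQ) (there z∈) with p ≟ q
  ... | yes refl = there (path-⊆ acyclic (P , uP) (Q , uQ) z∈)
  ... | no p≢q = contradiction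
        (proj₂ (walk-++ (walk-restrict P a∉P) (proj₂ (walk-reverse (walk-restrict Q a∉Q)))))
        (no-detour acyclic a~p a~q p≢q)

module TreeComponents {n : ℕ} (T : Tree n) where
  open Tree T
  open WalkProperties graph

  PathLeaves : (ℕ → Set) → ℕ → ℕ → Set
  PathLeaves S u w = ∃[ vs ] IsPath graph u w vs × ∃[ z ] z ∈ vs × ¬ S z

  module _ {S : ℕ → Set} where

    PathLeaves⇒¬InComponent : ∀ {u w} → PathLeaves S u w → ¬ InComponent graph S u w
    PathLeaves⇒¬InComponent (_ , P , z , z∈ , ¬Sz) (_ , W) with walk⇒path W
    ... | _ , R , uR = ¬Sz (lookup (walk-All R) (path-⊆ acyclic P (walk-weaken R , uR) z∈))

    InComponent⊎PathLeaves : Decidable S → ∀ {u w} → Vertex n u → Vertex n w →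
                             InComponent graph S u w ⊎ PathLeaves S u w
    InComponent⊎PathLeaves S? {u} {w} vu vw with walk⇒path (proj₂ (connected u w vu vw))
    ... | R , P , uR with all? S? R
    ...   | yes allS = inj₁ (R , walk-restrict P allS)
    ...   | no ¬allS = let z , z∈ , ¬Sz = find (¬All⇒Any¬ S? R ¬allS) in inj₂ (R , (P , uR) , z , z∈ , ¬Sz)

    InComponent? : Decidable S → ∀ {u w} → Vertex n u → Vertex n w → Dec (InComponent graph S u w)
    InComponent? S? vu vw with InComponent⊎PathLeaves S? vu vw
    ... | inj₁ reach = yes reach
    ... | inj₂ leave = no (PathLeaves⇒¬InComponent leave)

    ¬InComponent⇒PathLeaves : Decidable S → ∀ {u w} → Vertex n u → Vertex n w →
                              ¬ InComponent graph S u w → PathLeaves S u w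
    ¬InComponent⇒PathLeaves S? vu vw ¬reach with InComponent⊎PathLeaves S? vu vw
    ... | inj₁ reach = contradiction reach ¬reach
    ... | inj₂ leave = leave

    component-gap : Decidable S → ∀ {c a b} → Vertex n c → S c → 1 ≤ a → b ≤ n →
                    ¬ (∀ w → a ≤ w → w ≤ b → InComponent graph S c w) →
                    ∃[ w ] a ≤ w × w ≤ b × w ≢ c × PathLeaves S c w
    component-gap S? {c} {a} {b} vc Sc 1≤a b≤n gap =
      let w , a≤w , w≤b , ¬reach = ¬∀⟶∃¬-interval a b (λ a≤w w≤b → InComponent? S? vc (vertex a≤w w≤b)) gap
      in w , a≤w , w≤b , (λ w≡c → ¬reach (subst (InComponent graph S c) (sym w≡c) (_ , single vc Sc))) ,
         ¬InComponent⇒PathLeaves S? vc (vertex a≤w w≤b) ¬reach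
      where
      vertex : ∀ {w} → a ≤ w → w ≤ b → Vertex n w
      vertex a≤w w≤b = ≤-trans 1≤a a≤w , ≤-trans w≤b b≤n

  RPathSet⊆RSplitSet : ∀ x → RPathSet T x ⊆ RSplitSet T x
  RPathSet⊆RSplitSet x (x<z , z≤bound , vs , P , x′ , x′∈ , x′<x) =
    x<z , z≤bound , λ (_ , reach) →
      PathLeaves⇒¬InComponent (vs , P , x′ , x′∈ , <⇒≱ x′<x) (reach _ (<⇒≤ x<z) ≤-refl)

  RSplitSet⇒smaller-RPathSet : ∀ {x} → Vertex n x → ∀ {k} → RSplitSet T x k → ∃[ w ] RPathSet T x w × w ≤ k
  RSplitSet⇒smaller-RPathSet {x} vx@(1≤x , _) (x<k , k≤n , ¬potBeg)
    with component-gap (x ≤?_) vx ≤-refl 1≤x k≤n (¬potBeg ∘ (<⇒≤ x<k ,_))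
  ... | w , x≤w , w≤k , w≢x , vs , P , x′ , x′∈ , x≰x′ =
    w , (≤∧≢⇒< x≤w (w≢x ∘ sym) , ≤-trans w≤k k≤n , vs , P , x′ , x′∈ , ≰⇒> x≰x′) , w≤k

  LPathSet⊆LSplitSet : ∀ y → LPathSet T y ⊆ LSplitSet T y
  LPathSet⊆LSplitSet y (1≤z , z<y , vs , P , y′ , y′∈ , y<y′) =
    1≤z , z<y , λ (_ , reach) →
      PathLeaves⇒¬InComponent (vs , P , y′ , y′∈ , <⇒≱ y<y′) (reach _ ≤-refl (<⇒≤ z<y))

  LSplitSet⇒larger-LPathSet : ∀ {y} → Vertex n y → ∀ {k} → LSplitSet T y k → ∃[ w ] LPathSet T y w × k ≤ w
  LSplitSet⇒larger-LPathSet {y} vy@(_ , y≤n) (1≤k , k<y , ¬potEnd)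
    with component-gap (_≤? y) vy ≤-refl 1≤k y≤n (¬potEnd ∘ (<⇒≤ k<y ,_))
  ... | w , k≤w , w≤y , w≢y , vs , P , y′ , y′∈ , y′≰y =
    w , (≤-trans 1≤k k≤w , ≤∧≢⇒< w≤y w≢y , vs , P , y′ , y′∈ , ≰⇒> y′≰y) , k≤w

mainTheorem6 : ∀ (n : ℕ) (T : Tree n) →
    (∀ x → 1 ≤ x → x ≤ n → (r : Maybe ℕ) →
      IsMinOrInf (RSplitSet T x) r ⇔ IsMinOrInf (RPathSet T x) r)
    ×
    (∀ y → 1 ≤ y → y ≤ n → (r : Maybe ℕ) →
      IsMaxOrInf (LSplitSet T y) r ⇔ IsMaxOrInf (LPathSet T y) r)
mainTheorem6 n T =
  (λ x 1≤x x≤n → minOrInf-coinitial (RPathSet⊆RSplitSet x) (RSplitSet⇒smaller-RPathSet (1≤x , x≤n))) ,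
  (λ y 1≤y y≤n → maxOrInf-cofinal (LPathSet⊆LSplitSet y) (LSplitSet⇒larger-LPathSet (1≤y , y≤n)))
  where open TreeComponents T
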